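{- Let $\mathcal{X}$ be a program over the memory access alphabet, and suppose that for each $x \in \mathcal{X}$ a read-from function $\mathsf{rf}_x$ is given, assigning to each acquire $l \in E_x$ on a location $a$ a release $\mathsf{rf}_x(l) \in E_x$ on $a$. Suppose that for each $x \in \mathcal{X}$ the following hold with respect to release/acquire events: (synchronizes-with) $\mathsf{rf}_x(l) \preceq_x l$ for every acquire $l$; (write-coherence) any two releases on the same location are comparable under $\preceq_x$; (from-read) for every acquire $l$ and releases $s, s'$ on the same location, if $\mathsf{rf}_x(l) = s$ and $s \prec_x s'$ then $l \preceq_x s'$. Then $\mathcal{X}$ is SC-relaxed.
   Context: A partial string is a triple $x = (E_x, \alpha_x, \preceq_x)$ with $E_x$ a set of events, $\alpha_x$ a labelling of events by letters of an alphabet, and $\preceq_x$ a partial order on $E_x$; $s \prec_x s'$ means $s \preceq_x s'$ and $s \ne s'$. $\mathsf{P}_f$ is the set of finite partial strings. $y \sqsubseteq x$ means there is a label-preserving bijection $f\colon E_x \to E_y$ with $e \preceq_x e' \Rightarrow f(e) \preceq_y f(e')$. A program is a subset of $\mathsf{P}_f$ downward closed under $\sqsubseteq$. Memory access alphabet: fix disjoint sets of locations and registers; labels are load labels $(t, r, a)$ with $t \in \{\mathsf{none},\mathsf{acquire}\}$, $r$ a register, $a$ a location, and store labels $(t, a, b)$ with $t \in \{\mathsf{none},\mathsf{release}\}$, $a$ a location, $b \in \{0,1\}$. An event labelled $(\mathsf{acquire}, r, a)$ is an acquire on $a$; one labelled $(\mathsf{release}, a, b)$ is a release on $a$. A program $\mathcal{X}$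 is SC-relaxed if for every location $a$ and every $x \in \mathcal{X}$, the releases on $a$ are totally ordered by $\preceq_x$, and for every acquire $l$ and release $s$ on $a$ in $E_x$, $l \preceq_x s$ or $s \preceq_x l$. -}

module Defs where

open import Level using (0ℓ)
open import Data.Nat using (ℕ)
open import Data.Fin using (Fin)
open import Data.Bool using (Bool)
open import Data.Product using (Σ; ∃; _×_; proj₁)
open import Data.Sum using (_⊎_)
open import Relation.Nullary using (¬_)
open import Relation.Binary.PropositionalEquality using (_≡_)
open import Relation.Binary.Structures using (IsPartialOrder)
open import Function.Definitions using (Bijective)

-- Finite partial strings over an alphabet A.  The (finite) event set is
-- represented as Fin n; any finite event set is in bijection with some Fin n.
record PartialString (A : Set) : Set₁ where
  field
    n    : ℕ
    α    : Fin n → A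
    _≼_  : Fin n → Fin n → Set
    isPO : IsPartialOrder _≡_ _≼_

  E : Set
  E = Fin n

  _≺_ : E → E → Set
  s ≺ s' = (s ≼ s') × ¬ (s ≡ s')

open PartialString public

_⊑_ : {A : Set} → PartialString A → PartialString A → Set
_⊑_ {A} y x =
  Σ (E x → E y) λ f →
    Bijective _≡_ _≡_ f
    × (∀ e → α y (f e) ≡ α x e)
    × (∀ e e' → _≼_ x e e' → _≼_ y (f e) (f e'))

record Program (A : Set) : Set₂ where
  field
    Mem       : PartialString A → Set
    downClosed : ∀ x y → Mem x → y ⊑ x → Mem y
open Program public

data LoadType : Set where
  none acquire : LoadType

data StoreType : Set where
  none release : StoreType

data Label (Loc Reg : Set) : Set where
  load  : LoadType  → Reg → Loc  → Label Loc Reg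
  store : StoreType → Loc → Bool → Label Loc Reg

module _ {Loc Reg : Set} where

  IsAcquireOn : (x : PartialString (Label Loc Reg)) → E x → Loc → Set
  IsAcquireOn x e a = ∃ λ r → α x e ≡ load acquire r a

  IsReleaseOn : (x : PartialString (Label Loc Reg)) → E x → Loc → Set
  IsReleaseOn x e a = ∃ λ b → α x e ≡ store release a b

  ReadFrom : PartialString (Label Loc Reg) → Set
  ReadFrom x = (l : E x) (a : Loc) → IsAcquireOn x l a → Σ (E x) λ s → IsReleaseOn x s a

  SCRelaxed : Program (Label Loc Reg) → Set₁
  SCRelaxed X =
    ∀ (a : Loc) (x : PartialString (Label Loc Reg)) → Mem X x →
      (∀ s s' → IsReleaseOn x s a → IsReleaseOn x s' a → _≼_ x s s' ⊎ _≼_ x s' s)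
      × (∀ l s → IsAcquireOn x l a → IsReleaseOn x s a → _≼_ x l s ⊎ _≼_ x s l)

module Submission where

-- Write-coherence is already the first half of SC-relaxedness,
-- so only the comparability of an acquire l with a release s on the same
-- location remains.  Let r = rf(l) be the release l reads from; r ≼ l by
-- synchronizes-with, and r, s are comparable by write-coherence:
--   * s ≼ r   gives s ≼ r ≼ l;
--   * r = s   gives s ≼ l directly;
--   * r ≺ s   gives l ≼ s by from-read.

open import Defs
open import Data.Product using (_×_; _,_; proj₁; proj₂)
open import Data.Sum using (_⊎_; inj₁; inj₂)
open import Data.Fin.Properties using (_≟_)
open import Relation.Nullary using (¬_; yes; no)
open import Relation.Binary.Definitions using (Transitive; DecidableEquality)
open import Relation.Binary.PropositionalEquality using (_≡_; refl)
open import Relation.Binary.Structures using (IsPartialOrder)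

-- This is the order-theoretic core of
-- the argument: comparability is transported from r to l along r ≼ l.
comparable-through :
  {E : Set} {_≼_ : E → E → Set} → Transitive _≼_ → DecidableEquality E →
  ∀ {r l s} → r ≼ l → (r ≼ s ⊎ s ≼ r) →
  ((r ≼ s) × ¬ (r ≡ s) → l ≼ s) →
  l ≼ s ⊎ s ≼ l
comparable-through trans _   r≼l (inj₂ s≼r) _ = inj₂ (trans s≼r r≼l)
comparable-through trans _≟_ {r} {l} {s} r≼l (inj₁ r≼s) passes with r ≟ s
... | yes refl = inj₂ r≼l
... | no  r≢s  = inj₁ (passes (r≼s , r≢s))

≼-trans : {A : Set} (x : PartialString A) → Transitive (_≼_ x)
≼-trans x = IsPartialOrder.trans (isPO x)

proposition6 : {Loc Reg : Set} (X : Program (Label Loc Reg))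
    (rf : ∀ x → Mem X x → ReadFrom {Loc} {Reg} x) →
    (∀ x (x∈X : Mem X x) l a (p : IsAcquireOn x l a) →
    _≼_ x (proj₁ (rf x x∈X l a p)) l) →
    (∀ x → Mem X x → ∀ a s s' → IsReleaseOn x s a → IsReleaseOn x s' a →
    _≼_ x s s' ⊎ _≼_ x s' s) →
    (∀ x (x∈X : Mem X x) l a s s' (p : IsAcquireOn x l a) →
    IsReleaseOn x s a → IsReleaseOn x s' a →
    proj₁ (rf x x∈X l a p) ≡ s → _≺_ x s s' → _≼_ x l s') →
    SCRelaxed X
proposition6 X rf sync-with write-coh from-read a x x∈X =
  write-coh x x∈X a , acquire-comparable
  where
  acquire-comparable : ∀ l s → IsAcquireOn x l a → IsReleaseOn x s a →
                       _≼_ x l s ⊎ _≼_ x s l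
  acquire-comparable l s l-acq s-rel =
    comparable-through (≼-trans x) _≟_
      (sync-with x x∈X l a l-acq)
      (write-coh x x∈X a r s r-rel s-rel)
      (from-read x x∈X l a r s l-acq r-rel s-rel refl)
    where
    r = proj₁ (rf x x∈X l a l-acq)
    r-rel = proj₂ (rf x x∈X l a l-acq)
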